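{- Let $G$ be an inflation of an odd cycle $C$. Then $\chi(G)\le \omega(G)+s(G)$ and $oh(G)\ge \chi(G)$.
   Context: All graphs are finite, without loops or parallel edges. A graph $G$ is an inflation of a graph $H$ if $G$ can be obtained from $H$ by replacing each vertex of $H$ by a clique of order at least one (these cliques pairwise vertex-disjoint), where two such cliques are complete to each other (every vertex of one adjacent to every vertex of the other) if the corresponding vertices of $H$ are adjacent, and there are no edges between two such cliques if the corresponding vertices of $H$ are non-adjacent. In this situation $s(G)$ denotes the size of the smallest clique used to replace a vertex of $H$. $\chi(G)$ and $\omega(G)$ denote the chromatic number and clique number. A graph $G$ has an odd clique minor of size at least $k$ if there are $k$ vertex-disjoint trees in $G$ such that every two of them are joined by an edge of $G$, and all vertices of the trees can be two-colored so that every edge within a tree has ends of different colors while every edge joining two different trees (used as the joining edge) has ends of the same color (so in particular all trivial, one-vertex, trees receive the same color). The odd Hadwiger number $oh(G)$ is the largest integer $k$ such that $G$ has an odd clique minor of size $k$. -}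

module Defs where

open import Data.Nat using (ℕ; zero; suc; _+_; _*_; _∸_; _≤_; _<_)
open import Data.Fin using (Fin; toℕ)
open import Data.Bool using (Bool)
open import Data.Maybe using (Maybe; just)
open import Data.List using (length; filter)
open import Data.List using () renaming (List to L)
open import Data.Fin.Properties using () renaming (_≟_ to _≟ᶠ_)
open import Data.Product using (Σ; ∃; _×_; _,_)
open import Data.Sum using (_⊎_)
open import Relation.Binary.PropositionalEquality using (_≡_; _≢_)
open import Relation.Nullary using (¬_)
open import Function.Bundles using (_⇔_)

record Graph (m : ℕ) : Set₁ where
  field
    Adj    : Fin m → Fin m → Set
    sym    : ∀ {u v} → Adj u v → Adj v u
    irrefl : ∀ {u} → ¬ Adj u u
open Graph public

-- The cycle C_ℓ on Fin ℓ : i ~ i+1 (mod ℓ), written without mod.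
CycleAdj : (ℓ : ℕ) → Fin ℓ → Fin ℓ → Set
CycleAdj ℓ i j =
  (toℕ j ≡ suc (toℕ i)) ⊎ (toℕ i ≡ suc (toℕ j))
  ⊎ ((toℕ i ≡ ℓ ∸ 1) × (toℕ j ≡ 0)) ⊎ ((toℕ j ≡ ℓ ∸ 1) × (toℕ i ≡ 0))

OddCycleLength : ℕ → Set
OddCycleLength ℓ = (3 ≤ ℓ) × (∃ λ k → ℓ ≡ 2 * k + 1)

fibreSize : ∀ {m n} → (Fin m → Fin n) → Fin n → ℕ
fibreSize {m} φ i = length (filter (λ u → φ u ≟ᶠ i) (Data.List.allFin m))
  where import Data.List

-- G is an inflation of the cycle C_ℓ via φ : V(G) → V(C_ℓ), the fibres of φ
-- being the cliques replacing the vertices of C_ℓ (each of order ≥ 1).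
IsCycleInflation : ∀ {m} → Graph m → (ℓ : ℕ) → (Fin m → Fin ℓ) → Set
IsCycleInflation {m} G ℓ φ =
  (∀ i → ∃ λ u → φ u ≡ i)
  × (∀ u v → Adj G u v ⇔ (u ≢ v × (φ u ≡ φ v ⊎ CycleAdj ℓ (φ u) (φ v))))

IsMinFibreSize : ∀ {m ℓ} → (Fin m → Fin ℓ) → ℕ → Set
IsMinFibreSize φ s = (∃ λ i → fibreSize φ i ≡ s) × (∀ i → s ≤ fibreSize φ i)

Colorable : ∀ {m} → Graph m → ℕ → Set
Colorable {m} G c = Σ (Fin m → Fin c) λ f → ∀ u v → Adj G u v → f u ≢ f v

IsChromaticNumber : ∀ {m} → Graph m → ℕ → Set
IsChromaticNumber G c = Colorable G c × (∀ c' → Colorable G c' → c ≤ c')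

HasClique : ∀ {m} → Graph m → ℕ → Set
HasClique {m} G w = Σ (Fin w → Fin m) λ f →
  (∀ a b → f a ≡ f b → a ≡ b) × (∀ a b → a ≢ b → Adj G (f a) (f b))

IsCliqueNumber : ∀ {m} → Graph m → ℕ → Set
IsCliqueNumber G w = HasClique G w × (∀ w' → HasClique G w' → w' ≤ w)

-- Vertex u lies in tree t u (or in none).
-- Tree i is given in rooted form: root r i, and every non-root vertex u of
-- tree i has a parent par u in tree i, adjacent to u in G, of smaller depth;
-- the tree edges are exactly {u , par u} for non-root u.  col is the
-- 2-colouring: tree edges bichromatic; each pair of distinct trees is joined
-- by an edge of G whose ends have the same colour.
record OddCliqueMinor {m} (G : Graph m) (k : ℕ) : Set where
  field
    t     : Fin m → Maybe (Fin k)
    r     : Fin k → Fin m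
    par   : Fin m → Fin m
    depth : Fin m → ℕ
    col   : Fin m → Bool
    root-in   : ∀ i → t (r i) ≡ just i
    par-in    : ∀ i u → t u ≡ just i → u ≢ r i → t (par u) ≡ just i
    par-adj   : ∀ i u → t u ≡ just i → u ≢ r i → Adj G u (par u)
    par-depth : ∀ i u → t u ≡ just i → u ≢ r i → depth (par u) < depth u
    par-col   : ∀ i u → t u ≡ just i → u ≢ r i → col u ≢ col (par u)
    joined    : ∀ i j → i ≢ j → ∃ λ u → ∃ λ v →
                  (t u ≡ just i) × (t v ≡ just j) × Adj G u v × (col u ≡ col v)

IsOddHadwigerNumber : ∀ {m} → Graph m → ℕ → Set
IsOddHadwigerNumber G h = OddCliqueMinor G h × (∀ h' → OddCliqueMinor G h' → h' ≤ h)

module Submission where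

-- Number the cycle 0, …, n (n even) so that the smallest clique, of size s, sits at position 0, and
-- let W be the largest size of the union of two adjacent cliques avoiding position 0. Giving the
-- vertex of rank q in the clique at position x the colour W + q if x = 0, q if x is odd and
-- W − 1 − q if x > 0 is even is proper: adjacent cliques off position 0 have at most W vertices
-- together. So χ ≤ W + s, and the two heaviest adjacent cliques form a clique of size W. Rotating
-- them to positions 0 and 1, their W vertices are one-vertex trees of an odd minor, and for each
-- q < s the rank-q vertices at positions 2, …, n form a path; coloured by the parity of the
-- position, and with n even, every two of these W + s trees are joined by a monochromatic edge.

open import Defs hiding (sym)
open import Data.Bool using (Bool; true; false; not; if_then_else_)
open import Data.Bool.Properties using (not-¬; not-involutive)
open import Data.Empty using (⊥-elim)
open import Data.Fin using (Fin; toℕ; fromℕ<)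
open import Data.Fin.Properties using (toℕ-injective; toℕ<n; toℕ-fromℕ<; fromℕ<-toℕ)
  renaming (_≟_ to _≟ᶠ_)
open import Data.List using (List; _∷_; lookup; filter; allFin; length)
open import Data.List.Properties using (filter-≐)
open import Data.List.Membership.Propositional using (_∈_)
open import Data.List.Membership.Propositional.Properties using (∈-filter⁺; ∈-filter⁻; ∈-allFin; ∈-lookup)
open import Data.List.Relation.Unary.All as All using ()
open import Data.List.Relation.Unary.AllPairs using (_∷_)
open import Data.List.Relation.Unary.Any using (index)
open import Data.List.Relation.Unary.Any.Properties using (lookup-index)
open import Data.List.Relation.Unary.Unique.Propositional using (Unique)
open import Data.List.Relation.Unary.Unique.Propositional.Properties using (allFin⁺; filter⁺)
open import Data.Maybe using (Maybe; just; nothing)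
open import Data.Maybe.Properties using (just-injective)
open import Data.Nat
open import Data.Nat.DivMod using (_%_; m%n<n; m<n⇒m%n≡m; n%n≡0; m%n%n≡m%n; [m+n]%n≡m%n; %-distribˡ-+)
open import Data.Nat.Properties
open import Data.Product as Product using (∃; ∃-syntax; _×_; _,_; proj₁; proj₂)
open import Data.Sum as Sum using (_⊎_; inj₁; inj₂)
open import Function using (_∘_)
open import Function.Bundles using (_⇔_; mk⇔; Equivalence)
open import Function.Definitions using (Injective)
open import Relation.Binary.PropositionalEquality
open import Relation.Nullary using (¬_; yes; no; contradiction-irr)

lookup-injective : ∀ {a} {A : Set a} {xs : List A} → Unique xs →
                   ∀ {k k′} → lookup xs k ≡ lookup xs k′ → k ≡ k′
lookup-injective {xs = _ ∷ _} _ {Fin.zero} {Fin.zero} _ = refl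
lookup-injective {xs = _ ∷ _} (x∉ ∷ _) {Fin.zero} {Fin.suc k′} eq =
  ⊥-elim (All.lookup x∉ (∈-lookup k′) eq)
lookup-injective {xs = _ ∷ _} (x∉ ∷ _) {Fin.suc k} {Fin.zero} eq =
  ⊥-elim (All.lookup x∉ (∈-lookup k) (sym eq))
lookup-injective {xs = _ ∷ _} (_ ∷ u) {Fin.suc k} {Fin.suc k′} eq = cong Fin.suc (lookup-injective u eq)

module Fibres {m ℓ : ℕ} (φ : Fin m → Fin ℓ) where

  fibre : Fin ℓ → List (Fin m)
  fibre i = filter (λ u → φ u ≟ᶠ i) (allFin m)

  member : (i : Fin ℓ) (q : ℕ) → .(q < fibreSize φ i) → Fin m
  member i q q< = lookup (fibre i) (fromℕ< q<)

  φ-member : ∀ {i q} .{q<} → φ (member i q q<) ≡ i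
  φ-member {i} = proj₂ (∈-filter⁻ (λ u → φ u ≟ᶠ i) {xs = allFin m} (∈-lookup _))

  member-injective : ∀ {i q q′} .{q<} .{q′<} → member i q q< ≡ member i q′ q′< → q ≡ q′
  member-injective {i} {q} {q′} {q<} {q′<} eq = begin
    q                 ≡⟨ toℕ-fromℕ< q< ⟨
    toℕ (fromℕ< q<)   ≡⟨ cong toℕ (lookup-injective (filter⁺ (λ u → φ u ≟ᶠ i) (allFin⁺ m)) eq) ⟩
    toℕ (fromℕ< q′<)  ≡⟨ toℕ-fromℕ< q′< ⟩
    q′                ∎
    where open ≡-Reasoning

  ∈-fibre : ∀ u → u ∈ fibre (φ u)
  ∈-fibre u = ∈-filter⁺ (λ v → φ v ≟ᶠ φ u) (∈-allFin u) refl

  rank : Fin m → ℕ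
  rank u = toℕ (index (∈-fibre u))

  rank< : ∀ u → rank u < fibreSize φ (φ u)
  rank< u = toℕ<n (index (∈-fibre u))

  member-unique : ∀ {u i q} .{q<} → φ u ≡ i → rank u ≡ q → member i q q< ≡ u
  member-unique {u} refl refl =
    trans (cong (lookup (fibre (φ u))) (fromℕ<-toℕ _ (rank< u))) (sym (lookup-index (∈-fibre u)))

  rank-member : ∀ {i q} .{q<} → rank (member i q q<) ≡ q
  rank-member {i} {q} {q<} =
    member-injective (member-unique {q< = subst (λ j → rank v < fibreSize φ j) φ-member (rank< v)} φ-member refl)
    where v = member i q q<

  rank-injective : ∀ {u v} → φ u ≡ φ v → rank u ≡ rank v → u ≡ v
  rank-injective {v = v} φ≡ rank≡ =
    trans (sym (member-unique {q< = rank< v} φ≡ rank≡)) (member-unique refl refl)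

fibreSize-∘-injective : ∀ {m ℓ} (φ : Fin m → Fin ℓ) {ρ : Fin ℓ → Fin ℓ} →
                        Injective _≡_ _≡_ ρ → ∀ i → fibreSize (ρ ∘ φ) (ρ i) ≡ fibreSize φ i
fibreSize-∘-injective {m} φ {ρ} ρ-inj i =
  cong length (filter-≐ (λ u → ρ (φ u) ≟ᶠ ρ i) (λ u → φ u ≟ᶠ i) (ρ-inj , cong ρ) (allFin m))

m<n+o∧n≤m⇒m∸n<o : ∀ {m n o} → m < n + o → n ≤ m → m ∸ n < o
m<n+o∧n≤m⇒m∸n<o {m} {n} {o} m<n+o n≤m = subst (m ∸ n <_) (m+n∸m≡n n o) (∸-monoˡ-< m<n+o n≤m)

argmax≤ : (f : ℕ → ℕ) (b : ℕ) → ∃[ r ] r ≤ b × (∀ {k} → k ≤ b → f k ≤ f r)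
argmax≤ f zero = 0 , z≤n , λ { z≤n → ≤-refl }
argmax≤ f (suc b) with argmax≤ f b
... | r , r≤b , max with f (suc b) ≤? f r
...   | yes fb≤fr = r , m≤n⇒m≤1+n r≤b , λ k≤ →
  Sum.[ max ∘ s≤s⁻¹ , (λ { refl → fb≤fr }) ] (m≤n⇒m<n∨m≡n k≤)
...   | no  fb≰fr = suc b , ≤-refl , λ k≤ →
  Sum.[ (λ k< → ≤-trans (max (s≤s⁻¹ k<)) (<⇒≤ (≰⇒> fb≰fr))) , (λ { refl → ≤-refl }) ]
        (m≤n⇒m<n∨m≡n k≤)

restrict : ∀ {K} (x : Maybe ℕ) → (∀ {l} → x ≡ just l → l < K) → Maybe (Fin K)
restrict nothing  _     = nothing
restrict (just l) bound = just (fromℕ< (bound refl))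

restrict-just⁻ : ∀ {K} {x : Maybe ℕ} {bound : ∀ {l} → x ≡ just l → l < K} {i : Fin K} →
                 restrict x bound ≡ just i → x ≡ just (toℕ i)
restrict-just⁻ {x = just l} refl = cong just (sym (toℕ-fromℕ< _))

restrict-just⁺ : ∀ {K} {x : Maybe ℕ} {bound : ∀ {l} → x ≡ just l → l < K} {i : Fin K} →
                 x ≡ just (toℕ i) → restrict x bound ≡ just i
restrict-just⁺ {i = i} refl = cong just (fromℕ<-toℕ i _)

CycleAdj-sym : ∀ {ℓ} {i j : Fin ℓ} → CycleAdj ℓ i j → CycleAdj ℓ j i
CycleAdj-sym (inj₁ step)               = inj₂ (inj₁ step)
CycleAdj-sym (inj₂ (inj₁ step))        = inj₁ step
CycleAdj-sym (inj₂ (inj₂ (inj₁ wrap))) = inj₂ (inj₂ (inj₂ wrap))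
CycleAdj-sym (inj₂ (inj₂ (inj₂ wrap))) = inj₂ (inj₂ (inj₁ wrap))

module Rotation (n : ℕ) where

  at : ℕ → Fin (suc n)
  at k = fromℕ< (m%n<n k (suc n))

  toℕ-at : ∀ k → toℕ (at k) ≡ k % suc n
  toℕ-at k = toℕ-fromℕ< (m%n<n k (suc n))

  toℕ-at-< : ∀ {k} → k < suc n → toℕ (at k) ≡ k
  toℕ-at-< {k} k< = trans (toℕ-at k) (m<n⇒m%n≡m k<)

  at-toℕ : ∀ i → at (toℕ i) ≡ i
  at-toℕ i = toℕ-injective (toℕ-at-< (toℕ<n i))

  at-cong : ∀ k k′ → k % suc n ≡ k′ % suc n → at k ≡ at k′
  at-cong k k′ eq = toℕ-injective (trans (toℕ-at k) (trans eq (sym (toℕ-at k′))))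

  at-periodic : ∀ k → at (k + suc n) ≡ at k
  at-periodic k = at-cong (k + suc n) k ([m+n]%n≡m%n k (suc n))

  %-absorbˡ : ∀ k c → (k % suc n + c) % suc n ≡ (k + c) % suc n
  %-absorbˡ k c = begin
    (k % L + c) % L            ≡⟨ %-distribˡ-+ (k % L) c L ⟩
    (k % L % L + c % L) % L    ≡⟨ cong (λ x → (x + c % L) % L) (m%n%n≡m%n k L) ⟩
    (k % L + c % L) % L        ≡⟨ %-distribˡ-+ k c L ⟨
    (k + c) % L                ∎
    where open ≡-Reasoning
          L = suc n

  %-suc : ∀ k → suc k % suc n ≡ suc (k % suc n) % suc n
  %-suc k = begin
    suc k % suc n            ≡⟨ cong (_% suc n) (+-comm 1 k) ⟩
    (k + 1) % suc n          ≡⟨ %-absorbˡ k 1 ⟨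
    (k % suc n + 1) % suc n  ≡⟨ cong (_% suc n) (+-comm (k % suc n) 1) ⟩
    suc (k % suc n) % suc n  ∎
    where open ≡-Reasoning

  at-suc : ∀ k → CycleAdj (suc n) (at k) (at (suc k))
  at-suc k with m≤n⇒m<n∨m≡n (≤-pred (m%n<n k (suc n)))
  ... | inj₁ k%<n = inj₁ (begin
    toℕ (at (suc k))         ≡⟨ toℕ-at (suc k) ⟩
    suc k % suc n            ≡⟨ %-suc k ⟩
    suc (k % suc n) % suc n  ≡⟨ m<n⇒m%n≡m (s≤s k%<n) ⟩
    suc (k % suc n)          ≡⟨ cong suc (toℕ-at k) ⟨
    suc (toℕ (at k))         ∎)
    where open ≡-Reasoning
  ... | inj₂ k%≡n = inj₂ (inj₂ (inj₁ (trans (toℕ-at k) k%≡n , (begin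
    toℕ (at (suc k))         ≡⟨ toℕ-at (suc k) ⟩
    suc k % suc n            ≡⟨ %-suc k ⟩
    suc (k % suc n) % suc n  ≡⟨ cong (λ x → suc x % suc n) k%≡n ⟩
    suc n % suc n            ≡⟨ n%n≡0 (suc n) ⟩
    0                        ∎))))
    where open ≡-Reasoning

  rotate : ℕ → Fin (suc n) → Fin (suc n)
  rotate c i = at (toℕ i + c)

  rotate-at : ∀ c k → rotate c (at k) ≡ at (k + c)
  rotate-at c k =
    at-cong (toℕ (at k) + c) (k + c) (trans (cong (λ x → (x + c) % suc n) (toℕ-at k)) (%-absorbˡ k c))

  rotate-adj : ∀ c {i j} → CycleAdj (suc n) i j → CycleAdj (suc n) (rotate c i) (rotate c j)
  rotate-adj c {i} (inj₁ step) rewrite step = at-suc (toℕ i + c)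
  rotate-adj c (inj₂ (inj₁ step)) = CycleAdj-sym (rotate-adj c (inj₁ step))
  rotate-adj c {i} {j} (inj₂ (inj₂ (inj₁ (i≡n , j≡0)))) =
    subst₂ (CycleAdj (suc n)) (cong (λ x → at (x + c)) (sym i≡n)) last≡ (at-suc (n + c))
    where
    last≡ : at (suc (n + c)) ≡ rotate c j
    last≡ = begin
      at (suc n + c)  ≡⟨ cong at (+-comm (suc n) c) ⟩
      at (c + suc n)  ≡⟨ at-periodic c ⟩
      at c            ≡⟨ cong (λ x → at (x + c)) j≡0 ⟨
      rotate c j      ∎
      where open ≡-Reasoning
  rotate-adj c (inj₂ (inj₂ (inj₂ wrap))) = CycleAdj-sym (rotate-adj c (inj₂ (inj₂ (inj₁ wrap))))

  rotate-rotate : ∀ c c′ i → rotate c′ (rotate c i) ≡ rotate (c + c′) i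
  rotate-rotate c c′ i = trans (rotate-at c′ (toℕ i + c)) (cong at (+-assoc (toℕ i) c c′))

  rotate-period : ∀ i → rotate (suc n) i ≡ i
  rotate-period i = trans (at-periodic (toℕ i)) (at-toℕ i)

  rotate-undo : ∀ {c} → c ≤ suc n → ∀ i → rotate (suc n ∸ c) (rotate c i) ≡ i
  rotate-undo c≤ i =
    trans (rotate-rotate _ _ i) (trans (cong (λ c → rotate c i) (m+[n∸m]≡n c≤)) (rotate-period i))

  rotate-redo : ∀ {c} → c ≤ suc n → ∀ i → rotate c (rotate (suc n ∸ c) i) ≡ i
  rotate-redo c≤ i =
    trans (rotate-rotate _ _ i) (trans (cong (λ c → rotate c i) (m∸n+n≡m c≤)) (rotate-period i))

  rotate-injective : ∀ {c} → c ≤ suc n → Injective _≡_ _≡_ (rotate c)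
  rotate-injective c≤ {i} {j} eq = trans (sym (rotate-undo c≤ i)) (trans (cong (rotate _) eq) (rotate-undo c≤ j))

  rotate-inflation : ∀ {m} {G : Graph m} {φ : Fin m → Fin (suc n)} {c} → c ≤ suc n →
                     IsCycleInflation G (suc n) φ → IsCycleInflation G (suc n) (rotate c ∘ φ)
  rotate-inflation {G = G} {φ} {c} c≤ (onto , adj⇔) = onto′ , adj⇔′
    where
    onto′ : ∀ i → ∃ λ u → rotate c (φ u) ≡ i
    onto′ i with onto (rotate (suc n ∸ c) i)
    ... | u , φu≡ = u , trans (cong (rotate c) φu≡) (rotate-redo c≤ i)

    reflect-adj : ∀ {i j} → CycleAdj (suc n) (rotate c i) (rotate c j) → CycleAdj (suc n) i j
    reflect-adj adj = subst₂ (CycleAdj (suc n)) (rotate-undo c≤ _) (rotate-undo c≤ _) (rotate-adj (suc n ∸ c) adj)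

    adj⇔′ : ∀ u v → Adj G u v ⇔
            (u ≢ v × (rotate c (φ u) ≡ rotate c (φ v) ⊎ CycleAdj (suc n) (rotate c (φ u)) (rotate c (φ v))))
    adj⇔′ u v = mk⇔
      (λ adj → Product.map₂ (Sum.map (cong (rotate c)) (rotate-adj c)) (Equivalence.to (adj⇔ u v) adj))
      (λ rel → Equivalence.from (adj⇔ u v) (Product.map₂ (Sum.map (rotate-injective c≤) reflect-adj) rel))

  rotate-back : ∀ {k} → k ≤ suc n → ∀ j → rotate (suc n ∸ k) (at (j + k)) ≡ at j
  rotate-back {k} k≤ j = begin
    rotate (suc n ∸ k) (at (j + k)) ≡⟨ rotate-at (suc n ∸ k) (j + k) ⟩
    at (j + k + (suc n ∸ k))        ≡⟨ cong at (+-assoc j k (suc n ∸ k)) ⟩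
    at (j + (k + (suc n ∸ k)))      ≡⟨ cong (λ x → at (j + x)) (m+[n∸m]≡n k≤) ⟩
    at (j + suc n)                  ≡⟨ at-periodic j ⟩
    at j                            ∎
    where open ≡-Reasoning

  module _ {m} (φ : Fin m → Fin (suc n)) {c} (c≤ : c ≤ suc n) where

    fibreSize-rotate : ∀ i → fibreSize (rotate c ∘ φ) (rotate c i) ≡ fibreSize φ i
    fibreSize-rotate = fibreSize-∘-injective φ (rotate-injective c≤)

    fibreSize-rotate-lower-bound : ∀ {s} → (∀ i → s ≤ fibreSize φ i) →
                                   ∀ i → s ≤ fibreSize (rotate c ∘ φ) i
    fibreSize-rotate-lower-bound {s} s≤ i = subst (s ≤_) size≡ (s≤ i′)
      where
      i′ = rotate (suc n ∸ c) i
      size≡ = trans (sym (fibreSize-rotate i′)) (cong (fibreSize (rotate c ∘ φ)) (rotate-redo c≤ i))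

  fibreSize-rotate-back : ∀ {m} (φ : Fin m → Fin (suc n)) {k} (k≤ : k ≤ suc n) j →
                          fibreSize (rotate (suc n ∸ k) ∘ φ) (at j) ≡ fibreSize φ (at (j + k))
  fibreSize-rotate-back φ {k} k≤ j =
    trans (cong (fibreSize (rotate (suc n ∸ k) ∘ φ)) (sym (rotate-back k≤ j)))
          (fibreSize-rotate φ (m∸n≤m (suc n) k) _)

evenᵇ : ℕ → Bool
evenᵇ zero    = true
evenᵇ (suc k) = not (evenᵇ k)

evenᵇ-suc : ∀ k → evenᵇ (suc k) ≢ evenᵇ k
evenᵇ-suc k eq = not-¬ refl (sym eq)

evenᵇ-double : ∀ k → evenᵇ (k + k) ≡ true
evenᵇ-double zero    = refl
evenᵇ-double (suc k) rewrite +-suc k k = trans (not-involutive (evenᵇ (k + k))) (evenᵇ-double k)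

colorable-ℕ : ∀ {m} (G : Graph m) {c} (f : Fin m → ℕ) →
              (∀ u → f u < c) → (∀ {u v} → Adj G u v → f u ≢ f v) → Colorable G c
colorable-ℕ G f f< proper = (λ u → fromℕ< (f< u)) , λ u v adj eq →
  proper adj (trans (sym (toℕ-fromℕ< (f< u))) (trans (cong toℕ eq) (toℕ-fromℕ< (f< v))))

module Inflation {m} (G : Graph m) (n : ℕ) (ψ : Fin m → Fin (suc n))
                 (infl : IsCycleInflation G (suc n) ψ) where

  open Fibres ψ using (rank; rank<; member; φ-member; member-unique; rank-member; rank-injective)
  open Rotation n using (at; toℕ-at-<; at-toℕ)

  size : ℕ → ℕ
  size k = fibreSize ψ (at k)

  pos : Fin m → ℕ
  pos u = toℕ (ψ u)

  pos≤n : ∀ u → pos u ≤ n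
  pos≤n u = ≤-pred (toℕ<n (ψ u))

  rank<size : ∀ u → rank u < size (pos u)
  rank<size u = subst (λ i → rank u < fibreSize ψ i) (sym (at-toℕ (ψ u))) (rank< u)

  rank<size-at : ∀ {u k} → pos u ≡ k → rank u < size k
  rank<size-at {u} refl = rank<size u

  pos-member : ∀ {k q} .{q<} → k ≤ n → pos (member (at k) q q<) ≡ k
  pos-member k≤n = trans (cong toℕ φ-member) (toℕ-at-< (s≤s k≤n))

  member-at-unique : ∀ {u k q} .{q<} → pos u ≡ k → rank u ≡ q → member (at k) q q< ≡ u
  member-at-unique {u} refl = member-unique (sym (at-toℕ (ψ u)))

  adj-inv : ∀ {u v} → Adj G u v → u ≢ v × (ψ u ≡ ψ v ⊎ CycleAdj (suc n) (ψ u) (ψ v))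
  adj-inv {u} {v} = Equivalence.to (proj₂ infl u v)

  adj : ∀ {u v} → u ≢ v → ψ u ≡ ψ v ⊎ CycleAdj (suc n) (ψ u) (ψ v) → Adj G u v
  adj {u} {v} u≢v rel = Equivalence.from (proj₂ infl u v) (u≢v , rel)

  adj-same : ∀ {u v} → u ≢ v → pos u ≡ pos v → Adj G u v
  adj-same u≢v pos≡ = adj u≢v (inj₁ (toℕ-injective pos≡))

  adj-step : ∀ {u v} → suc (pos u) ≡ pos v → Adj G u v
  adj-step step = adj (λ { refl → 1+n≢n step }) (inj₂ (inj₁ (sym step)))

  adj-wrap : ∀ {u v} → 0 < n → pos u ≡ n → pos v ≡ 0 → Adj G u v
  adj-wrap 0<n u≡n v≡0 =
    adj (λ { refl → <-irrefl (trans (sym v≡0) u≡n) 0<n }) (inj₂ (inj₂ (inj₂ (inj₁ (u≡n , v≡0)))))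

  Step : Fin m → Fin m → Set
  Step u v = suc (pos u) ≡ pos v ⊎ (pos u ≡ n × pos v ≡ 0)

  adj-cases : ∀ {u v} → Adj G u v → (pos u ≡ pos v × rank u ≢ rank v) ⊎ Step u v ⊎ Step v u
  adj-cases adj with adj-inv adj
  ... | u≢v , inj₁ same = inj₁ (cong toℕ same , λ rank≡ → u≢v (rank-injective same rank≡))
  ... | _ , inj₂ (inj₁ step)               = inj₂ (inj₁ (inj₁ (sym step)))
  ... | _ , inj₂ (inj₂ (inj₁ step))        = inj₂ (inj₂ (inj₁ (sym step)))
  ... | _ , inj₂ (inj₂ (inj₂ (inj₁ wrap))) = inj₂ (inj₁ (inj₂ wrap))
  ... | _ , inj₂ (inj₂ (inj₂ (inj₂ wrap))) = inj₂ (inj₂ (inj₂ wrap))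

  heaviest-edge : 2 ≤ n → ∃[ r ] 1 ≤ r × r < n ×
                  (∀ {k} → 1 ≤ k → k < n → size k + size (suc k) ≤ size r + size (suc r))
  heaviest-edge 2≤n with argmax≤ (λ k → size (suc k) + size (suc (suc k))) (n ∸ 2)
  ... | r , r≤ , max = suc r , s≤s z≤n , subst (2 + r ≤_) (m+[n∸m]≡n 2≤n) (+-monoʳ-≤ 2 r≤) ,
                       λ { {suc k} _ k<n → max (∸-monoˡ-≤ 2 k<n) }

  module Colouring (2≤n : 2 ≤ n) (W : ℕ)
                   (edge≤W : ∀ {k} → 1 ≤ k → k < n → size k + size (suc k) ≤ W) where

    size≤W : ∀ {k} → 1 ≤ k → k ≤ n → size k ≤ W
    size≤W {suc k} 1≤k k≤n with m≤n⇒m<n∨m≡n k≤n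
    ... | inj₁ k<n = ≤-trans (m≤m+n _ _) (edge≤W 1≤k k<n)
    ... | inj₂ k≡n =
      ≤-trans (m≤n+m _ _) (edge≤W (≤-pred (subst (2 ≤_) (sym k≡n) 2≤n)) (subst (k <_) k≡n ≤-refl))

    colourAt : ℕ → ℕ → ℕ
    colourAt zero    q = W + q
    colourAt (suc x) q = if evenᵇ (suc x) then W ∸ suc q else q

    colour : Fin m → ℕ
    colour u = colourAt (pos u) (rank u)

    rank<W : ∀ u → 1 ≤ pos u → rank u < W
    rank<W u 1≤pos = <-≤-trans (rank<size u) (size≤W 1≤pos (pos≤n u))

    colourAt-<W : ∀ x {q} → 1 ≤ x → q < W → colourAt x q < W
    colourAt-<W (suc x) _ q<W with evenᵇ (suc x)
    ... | true  = ∸-monoʳ-< (s≤s z≤n) q<W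
    ... | false = q<W

    colourAt-< : ∀ x {q} → x ≤ n → q < size x → colourAt x q < W + size 0
    colourAt-< zero    _   q< = +-monoʳ-< W q<
    colourAt-< (suc x) x≤n q< =
      <-≤-trans (colourAt-<W (suc x) (s≤s z≤n) (<-≤-trans q< (size≤W (s≤s z≤n) x≤n))) (m≤m+n W _)

    colourAt-injective : ∀ x {q q′} → (1 ≤ x → q < W × q′ < W) →
                         colourAt x q ≡ colourAt x q′ → q ≡ q′
    colourAt-injective zero    _      = +-cancelˡ-≡ W _ _
    colourAt-injective (suc x) bounds with evenᵇ (suc x) | bounds (s≤s z≤n)
    ... | true  | q<W , q′<W = suc-injective ∘ ∸-cancelˡ-≡ q<W q′<W
    ... | false | _          = λ eq → eq

    apart : ∀ {q q′} → q + suc q′ < W → q ≢ W ∸ suc q′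
    apart {q} {q′} q+q′<W q≡ = <-irrefl (begin
      q + suc q′             ≡⟨ cong (_+ suc q′) q≡ ⟩
      W ∸ suc q′ + suc q′    ≡⟨ m∸n+n≡m (≤-trans (m≤n+m (suc q′) q) (<⇒≤ q+q′<W)) ⟩
      W                      ∎) q+q′<W
      where open ≡-Reasoning

    colourAt-step : ∀ x {q q′} → q < size (suc x) → q′ < size (suc (suc x)) → suc x < n →
                    colourAt (suc x) q ≢ colourAt (suc (suc x)) q′
    colourAt-step x {q} {q′} q< q′< x<n with evenᵇ (suc x)
    ... | true  =
      apart (≤-trans (+-mono-≤ q′< q<) (subst (_≤ W) (+-comm (size (suc x)) _) (edge≤W (s≤s z≤n) x<n))) ∘ sym
    ... | false = apart (≤-trans (+-mono-≤ q< q′<) (edge≤W (s≤s z≤n) x<n))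

    colour<W : ∀ u → 1 ≤ pos u → colour u < W
    colour<W u 1≤pos = colourAt-<W (pos u) 1≤pos (rank<W u 1≤pos)

    W≤colour : ∀ u → pos u ≡ 0 → W ≤ colour u
    W≤colour u pos≡0 = subst (λ x → W ≤ colourAt x (rank u)) (sym pos≡0) (m≤m+n W (rank u))

    colour-step : ∀ {u v} → Step u v → colour u ≢ colour v
    colour-step {u} {v} (inj₁ step) = go (pos u) (pos v) step (rank<size u) (rank<size v) (pos≤n v)
      where
      go : ∀ x y → suc x ≡ y → rank u < size x → rank v < size y → y ≤ n →
           colourAt x (rank u) ≢ colourAt y (rank v)
      go zero    _ refl _  v< y≤n eq =
        <⇒≱ (colourAt-<W 1 (s≤s z≤n) (<-≤-trans v< (size≤W (s≤s z≤n) y≤n)))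
            (subst (W ≤_) eq (m≤m+n W (rank u)))
      go (suc x) _ refl u< v< y≤n    = colourAt-step x u< v< y≤n
    colour-step {u} {v} (inj₂ (pos≡n , pos≡0)) eq =
      <⇒≱ (colour<W u (≤-trans (s≤s z≤n) (subst (2 ≤_) (sym pos≡n) 2≤n)))
          (subst (W ≤_) (sym eq) (W≤colour v pos≡0))

    colour-proper : ∀ {u v} → Adj G u v → colour u ≢ colour v
    colour-proper {u} {v} uv with adj-cases uv
    ... | inj₁ (pos≡ , rank≢) =
      rank≢ ∘ colourAt-injective (pos u) bounds ∘ subst (λ x → colour u ≡ colourAt x (rank v)) (sym pos≡)
      where bounds : 1 ≤ pos u → rank u < W × rank v < W
            bounds 1≤pos = rank<W u 1≤pos , rank<W v (subst (1 ≤_) pos≡ 1≤pos)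
    ... | inj₂ (inj₁ step) = colour-step step
    ... | inj₂ (inj₂ step) = colour-step step ∘ sym

    colourable : Colorable G (W + size 0)
    colourable = colorable-ℕ G colour (λ u → colourAt-< (pos u) (pos≤n u) (rank<size u)) colour-proper

  module Minor (2≤n : 2 ≤ n) (n-even : evenᵇ n ≡ true)
               (s : ℕ) (s≤size : ∀ i → s ≤ fibreSize ψ i) where

    W : ℕ
    W = size 0 + size 1

    K : ℕ
    K = W + s

    labelAt : ℕ → ℕ → Maybe ℕ
    labelAt 0             q = just q
    labelAt 1             q = just (size 0 + q)
    labelAt (suc (suc _)) q with q <? s
    ... | yes _ = just (W + q)
    ... | no  _ = nothing

    label : Fin m → Maybe ℕ
    label u = labelAt (pos u) (rank u)

    labelAt-path : ∀ {x q} → 2 ≤ x → .(q < s) → labelAt x q ≡ just (W + q)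
    labelAt-path {suc (suc x)} {q} (s≤s (s≤s z≤n)) q<s with q <? s
    ... | yes _   = refl
    ... | no  q≮s = contradiction-irr q<s q≮s

    labelAt-inv : ∀ x q {l} → labelAt x q ≡ just l →
                  (x ≡ 0 × l ≡ q) ⊎ (x ≡ 1 × l ≡ size 0 + q) ⊎ (2 ≤ x × q < s × l ≡ W + q)
    labelAt-inv 0             q refl = inj₁ (refl , refl)
    labelAt-inv 1             q refl = inj₂ (inj₁ (refl , refl))
    labelAt-inv (suc (suc x)) q eq with q <? s
    ... | yes q<s = inj₂ (inj₂ (s≤s (s≤s z≤n) , q<s , sym (just-injective eq)))
    ... | no  _   with () ← eq

    label< : ∀ u {l} → label u ≡ just l → l < K
    label< u eq with labelAt-inv (pos u) (rank u) eq
    ... | inj₁ (pos≡ , refl)       = <-≤-trans (rank<size-at pos≡) (≤-trans (m≤m+n _ _) (m≤m+n W s))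
    ... | inj₂ (inj₁ (pos≡ , refl)) = <-≤-trans (+-monoʳ-< (size 0) (rank<size-at pos≡)) (m≤m+n W s)
    ... | inj₂ (inj₂ (_ , q<s , refl)) = +-monoʳ-< W q<s

    tree : Fin m → Maybe (Fin K)
    tree u = restrict (label u) (label< u)

    pathVertex : (k q : ℕ) → .(q < s) → Fin m
    pathVertex k q q<s = member (at k) q (<-≤-trans q<s (s≤size (at k)))

    label-pathVertex : ∀ {k q} .(q<s : q < s) → 2 ≤ k → k ≤ n → label (pathVertex k q q<s) ≡ just (W + q)
    label-pathVertex q<s 2≤k k≤n = trans (cong₂ labelAt (pos-member k≤n) rank-member) (labelAt-path 2≤k q<s)

    cliqueVertex : (q : ℕ) → q < W → Fin m
    cliqueVertex q q<W with q <? size 0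
    ... | yes q<size₀ = member (at 0) q q<size₀
    ... | no  q≮size₀ = member (at 1) (q ∸ size 0) (m<n+o∧n≤m⇒m∸n<o q<W (≮⇒≥ q≮size₀))

    pos-cliqueVertex : ∀ q q<W → pos (cliqueVertex q q<W) ≤ 1
    pos-cliqueVertex q q<W with q <? size 0
    ... | yes _ = subst (_≤ 1) (sym (pos-member z≤n)) z≤n
    ... | no  _ = ≤-reflexive (pos-member (≤-trans (s≤s z≤n) 2≤n))

    label-cliqueVertex : ∀ q q<W → label (cliqueVertex q q<W) ≡ just q
    label-cliqueVertex q q<W with q <? size 0
    ... | yes _       = cong₂ labelAt (pos-member z≤n) rank-member
    ... | no  q≮size₀ = trans (cong₂ labelAt (pos-member (≤-trans (s≤s z≤n) 2≤n)) rank-member)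
                              (cong just (m+[n∸m]≡n (≮⇒≥ q≮size₀)))

    cliqueVertex-unique : ∀ {q u} (q<W : q < W) → pos u ≤ 1 → label u ≡ just q → cliqueVertex q q<W ≡ u
    cliqueVertex-unique {q} {u} q<W pos≤1 eq with labelAt-inv (pos u) (rank u) eq | q <? size 0
    ... | inj₁ (pos≡ , refl) | yes _ = member-at-unique pos≡ refl
    ... | inj₁ (pos≡ , refl) | no q≮ = ⊥-elim (q≮ (rank<size-at pos≡))
    ... | inj₂ (inj₁ (pos≡ , refl)) | yes q< = ⊥-elim (m+n≮m (size 0) _ q<)
    ... | inj₂ (inj₁ (pos≡ , refl)) | no _ = member-at-unique pos≡ (sym (m+n∸m≡n (size 0) (rank u)))
    ... | inj₂ (inj₂ (2≤pos , _)) | _ = ⊥-elim (<⇒≱ 2≤pos pos≤1)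

    offset<s : ∀ (i : Fin K) → ¬ toℕ i < W → toℕ i ∸ W < s
    offset<s i i≮W = m<n+o∧n≤m⇒m∸n<o (toℕ<n i) (≮⇒≥ i≮W)

    root : Fin K → Fin m
    root i with toℕ i <? W
    ... | yes i<W = cliqueVertex (toℕ i) i<W
    ... | no  i≮W = pathVertex 2 (toℕ i ∸ W) (offset<s i i≮W)

    label-root : ∀ i → label (root i) ≡ just (toℕ i)
    label-root i with toℕ i <? W
    ... | yes i<W = label-cliqueVertex (toℕ i) i<W
    ... | no  i≮W =
      trans (label-pathVertex (offset<s i i≮W) ≤-refl 2≤n) (cong just (m+[n∸m]≡n (≮⇒≥ i≮W)))

    root-unique : ∀ i {u} → pos u ≤ 2 → label u ≡ just (toℕ i) → root i ≡ u
    root-unique i {u} pos≤2 eq with toℕ i <? W | labelAt-inv (pos u) (rank u) eq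
    ... | yes i<W | inj₂ (inj₂ (_ , _ , i≡)) = ⊥-elim (<⇒≱ i<W (subst (W ≤_) (sym i≡) (m≤m+n W _)))
    ... | yes i<W | inj₁ (pos≡ , _)          = cliqueVertex-unique i<W (subst (_≤ 1) (sym pos≡) z≤n) eq
    ... | yes i<W | inj₂ (inj₁ (pos≡ , _))   = cliqueVertex-unique i<W (≤-reflexive pos≡) eq
    ... | no  i≮W | inj₁ (pos≡ , i≡)         =
          ⊥-elim (i≮W (subst (_< W) (sym i≡) (<-≤-trans (rank<size-at pos≡) (m≤m+n _ _))))
    ... | no  i≮W | inj₂ (inj₁ (pos≡ , i≡))  =
          ⊥-elim (i≮W (subst (_< W) (sym i≡) (+-monoʳ-< (size 0) (rank<size-at pos≡))))
    ... | no  i≮W | inj₂ (inj₂ (2≤pos , _ , i≡)) =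
          member-at-unique (≤-antisym pos≤2 2≤pos) (sym (trans (cong (_∸ W) i≡) (m+n∸m≡n W (rank u))))

    pos-root-clique : ∀ i → toℕ i < W → pos (root i) ≤ 1
    pos-root-clique i i<W′ with toℕ i <? W
    ... | yes i<W = pos-cliqueVertex (toℕ i) i<W
    ... | no  i≮W = ⊥-elim (i≮W i<W′)

    pos-root-path : ∀ i → ¬ toℕ i < W → pos (root i) ≡ 2
    pos-root-path i i≮W′ with toℕ i <? W
    ... | yes i<W = ⊥-elim (i≮W′ i<W)
    ... | no  _   = pos-member 2≤n

    root-in : ∀ i → tree (root i) ≡ just i
    root-in i = restrict-just⁺ (label-root i)

    root-injective : ∀ {i j} → root i ≡ root j → i ≡ j
    root-injective {i} {j} eq =
      toℕ-injective (just-injective (trans (sym (label-root i)) (trans (cong label eq) (label-root j))))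

    pathVertex-in : ∀ {k} j (j≮W : ¬ toℕ j < W) → 2 ≤ k → k ≤ n →
                    tree (pathVertex k (toℕ j ∸ W) (offset<s j j≮W)) ≡ just j
    pathVertex-in j j≮W 2≤k k≤n =
      restrict-just⁺ (trans (label-pathVertex (offset<s j j≮W) 2≤k k≤n)
                            (cong just (m+[n∸m]≡n (≮⇒≥ j≮W))))

    non-root : ∀ {i u} → tree u ≡ just i → u ≢ root i → 3 ≤ pos u × rank u < s × toℕ i ≡ W + rank u
    non-root {i} {u} in-i u≢root with pos u ≤? 2 | labelAt-inv (pos u) (rank u) (restrict-just⁻ in-i)
    ... | yes pos≤2 | _ = ⊥-elim (u≢root (sym (root-unique i pos≤2 (restrict-just⁻ in-i))))
    ... | no  pos≰2 | inj₁ (pos≡ , _) = ⊥-elim (pos≰2 (subst (_≤ 2) (sym pos≡) z≤n))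
    ... | no  pos≰2 | inj₂ (inj₁ (pos≡ , _)) = ⊥-elim (pos≰2 (subst (_≤ 2) (sym pos≡) (s≤s z≤n)))
    ... | no  pos≰2 | inj₂ (inj₂ (_ , rank<s , i≡)) = ≰⇒> pos≰2 , rank<s , i≡

    colourAt : ℕ → Bool
    colourAt 1 = true
    colourAt x = evenᵇ x

    colour : Fin m → Bool
    colour u = colourAt (pos u)

    colourAt-≤1 : ∀ {x} → x ≤ 1 → colourAt x ≡ true
    colourAt-≤1 z≤n       = refl
    colourAt-≤1 (s≤s z≤n) = refl

    colourAt-≥2 : ∀ {x} → 2 ≤ x → colourAt x ≡ evenᵇ x
    colourAt-≥2 (s≤s (s≤s _)) = refl

    colourAt-suc : ∀ {x} → 2 ≤ x → colourAt (suc x) ≢ colourAt x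
    colourAt-suc {x} (s≤s (s≤s _)) = evenᵇ-suc x

    parent : Fin m → Fin m
    parent u with rank u <? s
    ... | yes rank<s = pathVertex (pos u ∸ 1) (rank u) rank<s
    ... | no  _      = u

    module _ {i u} (in-i : tree u ≡ just i) (u≢root : u ≢ root i) where

      private
        3≤pos : 3 ≤ pos u
        3≤pos = proj₁ (non-root in-i u≢root)

        rank<s : rank u < s
        rank<s = proj₁ (proj₂ (non-root in-i u≢root))

        2≤pos∸1 : 2 ≤ pos u ∸ 1
        2≤pos∸1 = ∸-monoˡ-≤ 1 3≤pos

        pos∸1≤n : pos u ∸ 1 ≤ n
        pos∸1≤n = ≤-trans (m∸n≤m (pos u) 1) (pos≤n u)

        parent≡ : parent u ≡ pathVertex (pos u ∸ 1) (rank u) rank<s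
        parent≡ with rank u <? s
        ... | yes _     = refl
        ... | no  rank≮ = ⊥-elim (rank≮ rank<s)

        pos-parent≡ : pos (parent u) ≡ pos u ∸ 1
        pos-parent≡ = trans (cong pos parent≡) (pos-member pos∸1≤n)

        pos-parent : suc (pos (parent u)) ≡ pos u
        pos-parent = trans (cong suc pos-parent≡) (sym (+-∸-assoc 1 (≤-trans (s≤s z≤n) 3≤pos)))

      parent-in : tree (parent u) ≡ just i
      parent-in = restrict-just⁺ (begin
        label (parent u)                               ≡⟨ cong label parent≡ ⟩
        label (pathVertex (pos u ∸ 1) (rank u) rank<s) ≡⟨ label-pathVertex rank<s 2≤pos∸1 pos∸1≤n ⟩
        just (W + rank u)                              ≡⟨ cong just (proj₂ (proj₂ (non-root in-i u≢root))) ⟨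
        just (toℕ i)                                   ∎)
        where open ≡-Reasoning

      parent-adj : Adj G u (parent u)
      parent-adj = Graph.sym G (adj-step pos-parent)

      parent-depth : pos (parent u) < pos u
      parent-depth = ≤-reflexive pos-parent

      parent-colour : colour u ≢ colour (parent u)
      parent-colour = colourAt-suc (subst (2 ≤_) (sym pos-parent≡) 2≤pos∸1) ∘ trans (cong colourAt pos-parent)

    ≤1-cases : ∀ {x} → x ≤ 1 → x ≡ 0 ⊎ x ≡ 1
    ≤1-cases z≤n       = inj₁ refl
    ≤1-cases (s≤s z≤n) = inj₂ refl

    adj-≤1 : ∀ {u v} → u ≢ v → pos u ≤ 1 → pos v ≤ 1 → Adj G u v
    adj-≤1 u≢v pos-u≤1 pos-v≤1 with ≤1-cases pos-u≤1 | ≤1-cases pos-v≤1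
    ... | inj₁ u≡0 | inj₁ v≡0 = adj-same u≢v (trans u≡0 (sym v≡0))
    ... | inj₂ u≡1 | inj₂ v≡1 = adj-same u≢v (trans u≡1 (sym v≡1))
    ... | inj₁ u≡0 | inj₂ v≡1 = adj-step (trans (cong suc u≡0) (sym v≡1))
    ... | inj₂ u≡1 | inj₁ v≡0 = Graph.sym G (adj-step (trans (cong suc v≡0) (sym u≡1)))

    clique : HasClique G W
    clique = vertex , vertex-injective , λ q q′ q≢q′ →
      adj-≤1 (q≢q′ ∘ vertex-injective q q′) (pos-cliqueVertex _ _) (pos-cliqueVertex _ _)
      where
      vertex : Fin W → Fin m
      vertex q = cliqueVertex (toℕ q) (toℕ<n q)

      vertex-injective : ∀ q q′ → vertex q ≡ vertex q′ → q ≡ q′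
      vertex-injective q q′ eq = toℕ-injective (just-injective (begin
        just (toℕ q)      ≡⟨ label-cliqueVertex _ _ ⟨
        label (vertex q)  ≡⟨ cong label eq ⟩
        label (vertex q′) ≡⟨ label-cliqueVertex _ _ ⟩
        just (toℕ q′)     ∎))
        where open ≡-Reasoning

    Joined : Fin K → Fin K → Set
    Joined i j = ∃ λ u → ∃ λ v → tree u ≡ just i × tree v ≡ just j × Adj G u v × colour u ≡ colour v

    Joined-sym : ∀ {i j} → Joined i j → Joined j i
    Joined-sym (u , v , in-i , in-j , uv , col≡) = v , u , in-j , in-i , Graph.sym G uv , sym col≡

    joined-cliques : ∀ {i j} → i ≢ j → toℕ i < W → toℕ j < W → Joined i j
    joined-cliques {i} {j} i≢j i<W j<W =
      root i , root j , root-in i , root-in j ,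
      adj-≤1 (i≢j ∘ root-injective) (pos-root-clique i i<W) (pos-root-clique j j<W) ,
      trans (colourAt-≤1 (pos-root-clique i i<W)) (sym (colourAt-≤1 (pos-root-clique j j<W)))

    joined-paths : ∀ {i j} → i ≢ j → ¬ toℕ i < W → ¬ toℕ j < W → Joined i j
    joined-paths {i} {j} i≢j i≮W j≮W =
      root i , root j , root-in i , root-in j ,
      adj-same (i≢j ∘ root-injective) pos≡ , cong colourAt pos≡
      where pos≡ = trans (pos-root-path i i≮W) (sym (pos-root-path j j≮W))

    joined-clique-path : ∀ {i j} → toℕ i < W → ¬ toℕ j < W → Joined i j
    joined-clique-path {i} {j} i<W j≮W with ≤1-cases (pos-root-clique i i<W)
    ... | inj₁ pos≡0 =
      root i , v , root-in i , pathVertex-in j j≮W 2≤n ≤-refl ,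
      Graph.sym G (adj-wrap (≤-trans (s≤s z≤n) 2≤n) (pos-member ≤-refl) pos≡0) ,
      trans (cong colourAt pos≡0)
            (sym (trans (cong colourAt (pos-member ≤-refl)) (trans (colourAt-≥2 2≤n) n-even)))
      where v = pathVertex n (toℕ j ∸ W) (offset<s j j≮W)
    ... | inj₂ pos≡1 =
      root i , v , root-in i , pathVertex-in j j≮W ≤-refl 2≤n ,
      adj-step (trans (cong suc pos≡1) (sym (pos-member 2≤n))) ,
      trans (cong colourAt pos≡1) (sym (cong colourAt (pos-member 2≤n)))
      where v = pathVertex 2 (toℕ j ∸ W) (offset<s j j≮W)

    joined : ∀ i j → i ≢ j → Joined i j
    joined i j i≢j with toℕ i <? W | toℕ j <? W
    ... | yes i<W | yes j<W = joined-cliques i≢j i<W j<W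
    ... | yes i<W | no  j≮W = joined-clique-path i<W j≮W
    ... | no  i≮W | yes j<W = Joined-sym (joined-clique-path j<W i≮W)
    ... | no  i≮W | no  j≮W = joined-paths i≢j i≮W j≮W

    minor : OddCliqueMinor G K
    minor = record
      { t = tree ; r = root ; par = parent ; depth = pos ; col = colour
      ; root-in   = root-in
      ; par-in    = λ _ _ → parent-in
      ; par-adj   = λ _ _ → parent-adj
      ; par-depth = λ _ _ → parent-depth
      ; par-col   = λ _ _ → parent-colour
      ; joined    = joined
      }

evenᵇ-odd-length : ∀ {n k} → suc n ≡ 2 * k + 1 → evenᵇ n ≡ true
evenᵇ-odd-length {n} {k} eq = subst (λ x → evenᵇ x ≡ true) (sym n≡k+k) (evenᵇ-double k)
  where
  n≡k+k : n ≡ k + k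
  n≡k+k = suc-injective (begin
    suc n         ≡⟨ eq ⟩
    2 * k + 1     ≡⟨ +-comm (2 * k) 1 ⟩
    suc (2 * k)   ≡⟨ cong (λ x → suc (k + x)) (+-identityʳ k) ⟩
    suc (k + k)   ∎)
    where open ≡-Reasoning

module _ {m} {G : Graph m} {n} (2≤n : 2 ≤ n) (n-even : evenᵇ n ≡ true) where

  open Rotation n

  colouring-clique-minor₀ : ∀ {ψ s} → IsCycleInflation G (suc n) ψ →
                            fibreSize ψ (at 0) ≡ s → (∀ i → s ≤ fibreSize ψ i) →
                            ∃[ W ] Colorable G (W + s) × HasClique G W × OddCliqueMinor G (W + s)
  colouring-clique-minor₀ {ψ} {s} infl size₀≡s s≤size with Inflation.heaviest-edge G n ψ infl 2≤n
  ... | r , _ , r<n , heaviest =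
    W , subst (Colorable G ∘ (W +_)) size₀≡s colourable ,
    subst (HasClique G) W′≡W clique , subst (λ x → OddCliqueMinor G (x + s)) W′≡W minor
    where
    open Inflation G n ψ infl using (size)
    W = size r + size (suc r)
    open Inflation.Colouring G n ψ infl 2≤n W heaviest using (colourable)

    r≤ : r ≤ suc n
    r≤ = ≤-trans (<⇒≤ r<n) (n≤1+n n)

    -- the heaviest edge {r, r + 1} is moved to positions {0, 1}
    ψ′ = rotate (suc n ∸ r) ∘ ψ
    open Inflation.Minor G n ψ′ (rotate-inflation {G = G} (m∸n≤m (suc n) r) infl) 2≤n n-even s
           (fibreSize-rotate-lower-bound ψ (m∸n≤m (suc n) r) s≤size)
      renaming (W to W′) using (clique; minor)

    W′≡W : W′ ≡ W
    W′≡W = cong₂ _+_ (fibreSize-rotate-back ψ r≤ 0) (fibreSize-rotate-back ψ r≤ 1)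

  colouring-clique-minor : ∀ {φ s} → IsCycleInflation G (suc n) φ → IsMinFibreSize φ s →
                           ∃[ W ] Colorable G (W + s) × HasClique G W × OddCliqueMinor G (W + s)
  colouring-clique-minor {φ} {s} infl ((p , size-p≡s) , s≤size) =
    colouring-clique-minor₀ (rotate-inflation {G = G} c≤ infl) size₀≡s
                            (fibreSize-rotate-lower-bound φ c≤ s≤size)
    where
    c≤ : suc n ∸ toℕ p ≤ suc n
    c≤ = m∸n≤m (suc n) (toℕ p)

    size₀≡s : fibreSize (rotate (suc n ∸ toℕ p) ∘ φ) (at 0) ≡ s
    size₀≡s = begin
      fibreSize (rotate (suc n ∸ toℕ p) ∘ φ) (at 0) ≡⟨ fibreSize-rotate-back φ (<⇒≤ (toℕ<n p)) 0 ⟩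
      fibreSize φ (at (toℕ p))                      ≡⟨ cong (fibreSize φ) (at-toℕ p) ⟩
      fibreSize φ p                                 ≡⟨ size-p≡s ⟩
      s                                             ∎
      where open ≡-Reasoning

lemma2p1 : ∀ {m} (G : Graph m) (ℓ : ℕ) (φ : Fin m → Fin ℓ) →
    OddCycleLength ℓ → IsCycleInflation G ℓ φ →
    ∀ c w s h → IsChromaticNumber G c → IsCliqueNumber G w →
    IsMinFibreSize φ s → IsOddHadwigerNumber G h →
    (c ≤ w + s) × (c ≤ h)
lemma2p1 G (suc n) φ (s≤s 2≤n , k , odd) infl c w s h (_ , χ-min) (_ , ω-max) min-s (_ , oh-max) =
  let W , colourable , clique , minor =
        colouring-clique-minor {G = G} 2≤n (evenᵇ-odd-length {k = k} odd) infl min-s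
      c≤W+s = χ-min (W + s) colourable
  in ≤-trans c≤W+s (+-monoˡ-≤ s (ω-max W clique)) , ≤-trans c≤W+s (oh-max (W + s) minor)
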